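{- The nonsymmetric operad quotient $\mathsf{PAs}^{\leftarrow}/_{\equiv}$, where $\equiv$ is the relation defined below via the reversed sylvester predicate and $\mathrm{F}_1$, is isomorphic (as a nonsymmetric operad) to the duplicial operad $\mathsf{Dup}$.
   Context: A packed word is a word over $\mathbb{P}=\{1,2,\dots\}$ whose set of letters is $[n]=\{1,\dots,n\}$ for some $n$; $\mathfrak{P}[n]$ is the set of those with letter set exactly $[n]$. $\mathrm{inc}_{\alpha,\beta}(u)$ adds $\alpha$ to each letter of $u$ strictly greater than $\beta$. $\mathsf{PAs}^{\leftarrow}$ is the nonsymmetric operad with $\mathsf{PAs}^{\leftarrow}(n)$ having basis $\{\mathsf{E}_u: u\in\mathfrak{P}[n]\}$ and $\mathsf{E}_u\circ_i\mathsf{E}_v=\mathsf{E}_w$ for $v\in\mathfrak{P}[m]$, $w$ being obtained from $\mathrm{inc}_{m-1,i}(u)$ by replacing every occurrence of $i$ by $\mathrm{inc}_{i-1,0}(v)$. Let $\bar P$ be the predicate on $\mathbb{P}^*\times\mathbb{P}\times\mathbb{P}\times\mathbb{P}^*$ such that $\bar P(u,a,c,v)$ holds iff there is a letter $b$ in $u$ with $a \leq b < c$. Let $\equiv_{\bar P}$ be the reflexive-symmetric-transitive closure of the relation $u\,a\,c\,v \leftrightarrow u\,c\,a\,v$ for all $u,v,a,c$ with $\bar P(u,a,c,v)$, and $\theta(u)$ the lexicographically minimal word in the $\equiv_{\bar P}$-class of $u$. $\mathrm{F}_1(u)$ is obtained from $u$ by keeping only the first occurrence of each letter. Define $u \equiv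 v$ iff $\theta(\mathrm{F}_1(u)) = \theta(\mathrm{F}_1(v))$. This $\equiv$ is a nonsymmetric operad congruence of $\mathsf{PAs}^{\leftarrow}$ (compatible with all $\circ_i$), and $\mathsf{PAs}^{\leftarrow}/_{\equiv}$ denotes the quotient operad whose arity-$n$ component has basis the $\equiv$-classes of $\mathfrak{P}[n]$, with induced partial compositions. The duplicial operad $\mathsf{Dup}$: $\mathsf{Dup}(n)$ has basis $\{\mathsf{E}_t\}$ indexed by planar binary trees $t$ with $n$ internal nodes. $\mathsf{E}_t\circ_i\mathsf{E}_s = \mathsf{E}_r$ where $r$ is obtained by replacing the $i$-th internal node $x$ of $t$ in infix (in-order) traversal by a copy of $s$, grafting the left subtree of $x$ on the leftmost leaf of the copy and the right subtree of $x$ on the rightmost leaf of the copy. -}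

module Defs where

open import Data.Nat using (ℕ; zero; suc; _+_; _∸_; _≤_; _<_; _≤ᵇ_; _≡ᵇ_; _<ᵇ_)
open import Data.Nat.Properties using (_≟_)
open import Data.List using (List; []; _∷_; _++_; map; concatMap; deduplicate)
open import Data.List.Membership.Propositional using (_∈_)
open import Data.Bool using (if_then_else_)
open import Data.Product using (Σ; ∃; ∃-syntax; _×_; _,_)
open import Data.Sum using (_⊎_)
open import Relation.Binary.PropositionalEquality using (_≡_)
open import Relation.Binary.Construct.Closure.Equivalence using (EqClosure)
open import Function.Bundles using (_⇔_)

Packed : ℕ → List ℕ → Set
Packed n u = (∀ x → x ∈ u → 1 ≤ x × x ≤ n) × (∀ x → 1 ≤ x → x ≤ n → x ∈ u)

inc : ℕ → ℕ → List ℕ → List ℕ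
inc α β = map (λ x → if β <ᵇ x then x + α else x)

-- partial composition of PAs^← on words: E_u ∘_i E_v = E_(compW i m u v),
-- where v ∈ 𝔓[m]
compW : ℕ → ℕ → List ℕ → List ℕ → List ℕ
compW i m u v =
  concatMap (λ x → if x ≡ᵇ i then inc (i ∸ 1) 0 v else x ∷ [])
            (inc (m ∸ 1) i u)

P̄ : List ℕ → ℕ → ℕ → List ℕ → Set
P̄ u a c v = ∃[ b ] (b ∈ u × a ≤ b × b < c)

data Step : List ℕ → List ℕ → Set where
  step : ∀ u a c v → P̄ u a c v → Step (u ++ a ∷ c ∷ v) (u ++ c ∷ a ∷ v)

_≡P̄_ : List ℕ → List ℕ → Set
_≡P̄_ = EqClosure Step

data _≤lex_ : List ℕ → List ℕ → Set where
  []≤  : ∀ {y} → [] ≤lex y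
  <∷   : ∀ {a b x y} → a < b → (a ∷ x) ≤lex (b ∷ y)
  ≡∷   : ∀ {a x y} → x ≤lex y → (a ∷ x) ≤lex (a ∷ y)

-- IsTheta x w : w = θ(x), the lexicographically minimal word of the ≡_P̄-class of x
IsTheta : List ℕ → List ℕ → Set
IsTheta x w = (w ≡P̄ x) × (∀ z → z ≡P̄ x → w ≤lex z)

F₁ : List ℕ → List ℕ
F₁ = deduplicate _≟_

_≈_ : List ℕ → List ℕ → Set
u ≈ v = ∃[ w ] (IsTheta (F₁ u) w × IsTheta (F₁ v) w)

data Tree : Set where
  leaf : Tree
  node : Tree → Tree → Tree

size : Tree → ℕ
size leaf       = 0
size (node l r) = suc (size l + size r)

graftL : Tree → Tree → Tree
graftL leaf       t = t
graftL (node l r) t = node (graftL l t) r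

graftR : Tree → Tree → Tree
graftR leaf       t = t
graftR (node l r) t = node l (graftR r t)

-- E_t ∘_i E_s = E_(compT i t s): replace the i-th internal node (infix order,
-- 1-based) x of t by s, grafting the left subtree of x on the leftmost leaf
-- of s and the right subtree of x on the rightmost leaf of s
compT : ℕ → Tree → Tree → Tree
compT i leaf       s = leaf
compT i (node l r) s =
  if i ≤ᵇ size l then node (compT i l s) r
  else if i ≡ᵇ suc (size l) then graftR (graftL s l) r
  else node l (compT (i ∸ suc (size l)) r s)

-- A nonsymmetric operad isomorphism PAs^←/≡ → Dup, presented by a map φ on
-- words: it sends arity n to arity n, induces a well-defined bijection
-- between ≡-classes of 𝔓[n] and trees with n internal nodes (n ≥ 1), and
-- commutes with all partial compositions ∘_i.
record IsOperadIso (φ : List ℕ → Tree) : Set where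
  field
    arity    : ∀ n u → 1 ≤ n → Packed n u → size (φ u) ≡ n
    classes  : ∀ n u v → 1 ≤ n → Packed n u → Packed n v → (u ≈ v ⇔ φ u ≡ φ v)
    surj     : ∀ n t → 1 ≤ n → size t ≡ n → ∃[ u ] (Packed n u × φ u ≡ t)
    compat   : ∀ n m i u v → 1 ≤ n → 1 ≤ m → Packed n u → Packed m v →
               1 ≤ i → i ≤ n → φ (compW i m u v) ≡ compT i (φ u) (φ v)

{-# OPTIONS --safe #-}
-- A word u is sent to the shape of its binary search tree: the first letter is the root, the
-- smaller and larger letters after it form the left and right subtrees, repeated letters are
-- ignored.  This tree does not see F₁, and a P̄-swap u a c v ↔ u c a v does not change it because
-- the letter b of u with a ≤ b < c separates a from c before they are compared.  Conversely, for a
-- word without repetitions the preorder reading of its tree is ≡_P̄-equivalent to it (the letters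
-- after a pivot can be sorted to its two sides) and lexicographically below it, so it is θ; for a
-- packed word this reading is the in-order labelling of the shape, so θ(F₁ u) and the shape
-- determine each other.  In E_u ∘_i E_v the letter i becomes a block of consecutive letters and
-- the larger letters are shifted, so in the tree the block's own tree replaces node i and the two
-- subtrees of i hang from its extreme leaves: this is the composition of Dup.

module Submission where

open import Defs
open import Data.Bool using (true; false; if_then_else_)
open import Data.Empty using (⊥-elim)
open import Data.List using (List; []; _∷_; [_]; _++_; length; map; filter; concatMap; deduplicate)
open import Data.List.Properties using (filter-++; filter-all; filter-none; filter-accept; filter-reject; filter-≐; length-filter; ++-assoc; ++-identityʳ; concatMap-map; concatMap-cong)
open import Data.List.Membership.Propositional using (_∈_; _∉_)
open import Data.List.Membership.Propositional.Properties using (∈-filter⁺; ∈-filter⁻; ∈-++⁺ˡ; ∈-++⁺ʳ; ∈-++⁻; ∈-concatMap⁻; ∈-map⁺; ∈-map⁻; ∈-deduplicate⁺; ∈-deduplicate⁻)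
open import Data.List.Relation.Unary.Any using (here; there; tail; satisfied)
import Data.List.Relation.Unary.All as All
open import Data.List.Relation.Unary.All.Properties using (All¬⇒¬Any)
open import Data.List.Relation.Unary.Any.Properties using (¬Any[])
open import Data.List.Relation.Unary.AllPairs using (_∷_)
open import Data.List.Relation.Unary.Unique.Propositional using (Unique)
import Data.List.Relation.Unary.Unique.Propositional.Properties as Unique
open import Data.List.Relation.Unary.Unique.DecPropositional.Properties using (deduplicate-!)
open import Data.List.Relation.Binary.Permutation.Propositional using (_↭_; ↭-refl; ↭-isEquivalence; ↭⇒↭ₛ′) renaming (swap to ↭-swap)
open import Data.List.Relation.Binary.Permutation.Propositional.Properties using (++⁺ˡ; ↭-length)
import Data.List.Relation.Binary.Permutation.Setoid.Properties as PermutationSetoid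
open import Data.Nat using (ℕ; zero; suc; _+_; _∸_; _≤_; _<_; _<ᵇ_; _≤ᵇ_; _≡ᵇ_; z≤n; s≤s; s≤s⁻¹; _≤?_; _<?_)
open import Data.Nat.Properties
open import Data.Product using (Σ-syntax; _×_; _,_; proj₁; proj₂; swap)
open import Data.Sum using (_⊎_; inj₁; inj₂; fromInj₁)
open import Function using (_∘_; id; _⇔_; mk⇔; Equivalence)
open import Level using (Level; 0ℓ)
open import Relation.Binary.Core using (_Preserves_⟶_)
open import Relation.Binary.Definitions using (DecidableEquality; Tri; tri<; tri≈; tri>)
open import Relation.Binary.PropositionalEquality using (_≡_; _≢_; refl; sym; trans; cong; cong₂; subst; subst₂; isEquivalence; setoid; module ≡-Reasoning)
open import Relation.Binary.Construct.Closure.Equivalence using (gmap; gfold; fold; symmetric)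
open import Relation.Binary.Construct.Closure.Symmetric using (bwd)
open import Relation.Binary.Construct.Closure.ReflexiveTransitive using (ε; _◅_; _◅◅_)
open import Relation.Nullary using (¬_; ¬?; yes; no; contradiction; _×-dec_)
open import Relation.Unary using (Pred; Decidable; _⊇_)
open import Relation.Unary.Properties using (_∩?_)

private
  variable
    ℓ ℓ′ : Level
    A B : Set ℓ

module _ {P : Pred A ℓ} {Q : Pred A ℓ′} (P? : Decidable P) (Q? : Decidable Q) where

  filter-filter : ∀ xs → filter P? (filter Q? xs) ≡ filter (P? ∩? Q?) xs
  filter-filter [] = refl
  filter-filter (x ∷ xs) with Q? x
  ... | yes _ with P? x
  ...   | yes _ = cong (x ∷_) (filter-filter xs)
  ...   | no _  = filter-filter xs
  filter-filter (x ∷ xs) | no _ with P? x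
  ...   | yes _ = filter-filter xs
  ...   | no _  = filter-filter xs

module _ {P : Pred A ℓ} {Q : Pred A ℓ′} (P? : Decidable P) (Q? : Decidable Q) where

  filter-filter-⊆ : Q ⊇ P → ∀ xs → filter P? (filter Q? xs) ≡ filter P? xs
  filter-filter-⊆ P⊆Q xs =
    trans (filter-filter P? Q? xs) (filter-≐ (P? ∩? Q?) P? (proj₁ , λ p → p , P⊆Q p) xs)

  filter-comm : ∀ xs → filter P? (filter Q? xs) ≡ filter Q? (filter P? xs)
  filter-comm xs = begin
    filter P? (filter Q? xs) ≡⟨ filter-filter P? Q? xs ⟩
    filter (P? ∩? Q?) xs     ≡⟨ filter-≐ (P? ∩? Q?) (Q? ∩? P?) (swap , swap) xs ⟩
    filter (Q? ∩? P?) xs     ≡⟨ filter-filter Q? P? xs ⟨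
    filter Q? (filter P? xs) ∎
    where open ≡-Reasoning

module _ {P : Pred B ℓ} {Q : Pred A ℓ′} (P? : Decidable P) (Q? : Decidable Q) where

  filter-concatMap : (f : A → List B) → (∀ x {z} → z ∈ f x → P z ⇔ Q x) →
                     ∀ xs → filter P? (concatMap f xs) ≡ concatMap f (filter Q? xs)
  filter-concatMap f P⇔Q [] = refl
  filter-concatMap f P⇔Q (x ∷ xs) with Q? x
  ... | yes q = trans (filter-++ P? (f x) _)
                  (cong₂ _++_ (filter-all P? (All.tabulate λ z∈ → Equivalence.from (P⇔Q x z∈) q))
                              (filter-concatMap f P⇔Q xs))
  ... | no ¬q = trans (filter-++ P? (f x) _)
                  (cong₂ _++_ (filter-none P? (All.tabulate λ z∈ → ¬q ∘ Equivalence.to (P⇔Q x z∈)))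
                              (filter-concatMap f P⇔Q xs))

  filter-map : (g : A → B) → (∀ x → P (g x) ⇔ Q x) →
               ∀ xs → filter P? (map g xs) ≡ map g (filter Q? xs)
  filter-map g P⇔Q [] = refl
  filter-map g P⇔Q (x ∷ xs) with P? (g x) | Q? x
  ... | yes _ | yes _ = cong (g x ∷_) (filter-map g P⇔Q xs)
  ... | yes p | no ¬q = contradiction (Equivalence.to (P⇔Q x) p) ¬q
  ... | no ¬p | yes q = contradiction (Equivalence.from (P⇔Q x) q) ¬p
  ... | no _  | no _  = filter-map g P⇔Q xs

module _ {P : Pred A ℓ} (P? : Decidable P) {a c : A} (v : List A) where

  filter-swap : ¬ (P a × P c) → filter P? (a ∷ c ∷ v) ≡ filter P? (c ∷ a ∷ v)
  filter-swap ¬pa×pc with P? a | P? c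
  ... | yes pa | yes pc = contradiction (pa , pc) ¬pa×pc
  ... | yes pa | no ¬pc = trans (cong (a ∷_) (filter-reject P? ¬pc)) (sym (filter-accept P? pa))
  ... | no ¬pa | yes pc = trans (filter-accept P? pc) (cong (c ∷_) (sym (filter-reject P? ¬pa)))
  ... | no ¬pa | no ¬pc = trans (filter-reject P? ¬pc) (sym (filter-reject P? ¬pa))

  filter-accept₂ : P a → P c → filter P? (a ∷ c ∷ v) ≡ a ∷ c ∷ filter P? v
  filter-accept₂ pa pc = trans (filter-accept P? pa) (cong (a ∷_) (filter-accept P? pc))

module _ (_≟ₐ_ : DecidableEquality A) {P : Pred A ℓ} (P? : Decidable P) where

  filter-deduplicate : ∀ xs → filter P? (deduplicate _≟ₐ_ xs) ≡ deduplicate _≟ₐ_ (filter P? xs)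
  filter-deduplicate [] = refl
  filter-deduplicate (x ∷ xs) with P? x
  ... | yes _  = cong (x ∷_) (trans (filter-comm P? (¬? ∘ (x ≟ₐ_)) (deduplicate _≟ₐ_ xs))
                                    (cong (filter (¬? ∘ (x ≟ₐ_))) (filter-deduplicate xs)))
  ... | no ¬px = trans (filter-filter-⊆ P? (¬? ∘ (x ≟ₐ_)) (λ pz x≡z → ¬px (subst P (sym x≡z) pz)) (deduplicate _≟ₐ_ xs))
                       (filter-deduplicate xs)

-- Binary search trees of words

below above atLeast : ℕ → List ℕ → List ℕ
below x = filter (_<? x)
above x = filter (x <?_)
atLeast x = filter (x ≤?_)

data LTree : Set where
  tip : LTree
  bin : LTree → ℕ → LTree → LTree

shape : LTree → Tree
shape tip         = leaf
shape (bin l _ r) = node (shape l) (shape r)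

preorder : LTree → List ℕ
preorder tip         = []
preorder (bin l x r) = x ∷ preorder l ++ preorder r

bstWithFuel : ℕ → List ℕ → LTree
bstWithFuel zero    _       = tip
bstWithFuel (suc n) []      = tip
bstWithFuel (suc n) (x ∷ w) = bin (bstWithFuel n (below x w)) x (bstWithFuel n (above x w))

bst : List ℕ → LTree
bst w = bstWithFuel (length w) w

bstWithFuel-irrelevant : ∀ m n w → length w ≤ m → length w ≤ n → bstWithFuel m w ≡ bstWithFuel n w
bstWithFuel-irrelevant zero    zero    []      _ _ = refl
bstWithFuel-irrelevant zero    (suc n) []      _ _ = refl
bstWithFuel-irrelevant (suc m) zero    []      _ _ = refl
bstWithFuel-irrelevant (suc m) (suc n) []      _ _ = refl
bstWithFuel-irrelevant (suc m) (suc n) (x ∷ w) (s≤s w≤m) (s≤s w≤n) =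
  cong₂ (λ l r → bin l x r) (irrelevant (_<? x)) (irrelevant (x <?_))
  where
  irrelevant : ∀ {P : Pred ℕ 0ℓ} (P? : Decidable P) →
               bstWithFuel m (filter P? w) ≡ bstWithFuel n (filter P? w)
  irrelevant P? = bstWithFuel-irrelevant m n (filter P? w)
                    (≤-trans (length-filter P? w) w≤m) (≤-trans (length-filter P? w) w≤n)

bstWithFuel-bst : ∀ n w → length w ≤ n → bstWithFuel n w ≡ bst w
bstWithFuel-bst n w w≤n = bstWithFuel-irrelevant n (length w) w w≤n ≤-refl

bst-∷ : ∀ x w → bst (x ∷ w) ≡ bin (bst (below x w)) x (bst (above x w))
bst-∷ x w = cong₂ (λ l r → bin l x r)
  (bstWithFuel-bst (length w) (below x w) (length-filter _ w))
  (bstWithFuel-bst (length w) (above x w) (length-filter _ w))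

module _ {x y : ℕ} {w : List ℕ} where

  below-∷-< : y < x → below x (y ∷ w) ≡ y ∷ below x w
  below-∷-< = filter-accept (_<? x)

  below-∷-> : x < y → below x (y ∷ w) ≡ below x w
  below-∷-> = filter-reject (_<? x) ∘ <⇒≯

  above-∷-< : y < x → above x (y ∷ w) ≡ above x w
  above-∷-< = filter-reject (x <?_) ∘ <⇒≯

  above-∷-> : x < y → above x (y ∷ w) ≡ y ∷ above x w
  above-∷-> = filter-accept (x <?_)

module _ {y z : ℕ} {p : List ℕ} (z∈y∷p : z ∈ y ∷ p) where

  ∈-below-∷ : z < y → z ∈ below y p
  ∈-below-∷ z<y = ∈-filter⁺ (_<? y) (tail (<⇒≢ z<y) z∈y∷p) z<y

  ∈-above-∷ : y < z → z ∈ above y p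
  ∈-above-∷ y<z = ∈-filter⁺ (y <?_) (tail (<⇒≢ y<z ∘ sym) z∈y∷p) y<z

bstShape : List ℕ → Tree
bstShape w = shape (bst w)

bstPreorder : List ℕ → List ℕ
bstPreorder w = preorder (bst w)

bstShape-∷ : ∀ x w → bstShape (x ∷ w) ≡ node (bstShape (below x w)) (bstShape (above x w))
bstShape-∷ x w = cong shape (bst-∷ x w)

bstPreorder-∷ : ∀ x w → bstPreorder (x ∷ w) ≡ x ∷ bstPreorder (below x w) ++ bstPreorder (above x w)
bstPreorder-∷ x w = cong preorder (bst-∷ x w)

module _ (P : List ℕ → Set ℓ) (P[] : P [])
         (P∷ : ∀ x w → P (below x w) → P (above x w) → P (x ∷ w)) where

  pivot-induction : ∀ w → P w
  pivot-induction w = withFuel (length w) w ≤-refl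
    where
    withFuel : ∀ n w → length w ≤ n → P w
    withFuel _       []      _         = P[]
    withFuel zero    (x ∷ w) ()
    withFuel (suc n) (x ∷ w) (s≤s w≤n) =
      P∷ x w (withFuel n (below x w) (≤-trans (length-filter _ w) w≤n))
             (withFuel n (above x w) (≤-trans (length-filter _ w) w≤n))

record Spans (l h : ℕ) (w : List ℕ) : Set where
  field
    bounded  : ∀ {y} → y ∈ w → l ≤ y × y < h
    complete : ∀ {y} → l ≤ y → y < h → y ∈ w
open Spans

Spans-[] : ∀ {l h} → Spans l h [] → h ≤ l
Spans-[] s = ≮⇒≥ λ l<h → ¬Any[] (complete s ≤-refl l<h)

Spans-below : ∀ {l h x w} → Spans l h (x ∷ w) → Spans l x (below x w)
Spans-below {x = x} {w} s = record
  { bounded  = λ y∈ → let y∈w , y<x = ∈-filter⁻ (_<? x) y∈ in proj₁ (bounded s (there y∈w)) , y<x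
  ; complete = λ l≤y y<x → ∈-below-∷ (complete s l≤y (<-trans y<x (proj₂ (bounded s (here refl))))) y<x
  }

Spans-above : ∀ {l h x w} → Spans l h (x ∷ w) → Spans (suc x) h (above x w)
Spans-above {x = x} {w} s = record
  { bounded  = λ y∈ → let y∈w , x<y = ∈-filter⁻ (x <?_) y∈ in x<y , proj₂ (bounded s (there y∈w))
  ; complete = λ x<y y<h → ∈-above-∷ (complete s (≤-trans (proj₁ (bounded s (here refl))) (<⇒≤ x<y)) y<h) x<y
  }

Spans-join : ∀ {l h x A B} → l ≤ x → x < h → Spans l x A → Spans (suc x) h B → Spans l h (x ∷ A ++ B)
Spans-join {l} {h} {x} {A} {B} l≤x x<h sA sB = record { bounded = bnd ; complete = cmp }
  where
  bnd : ∀ {y} → y ∈ x ∷ A ++ B → l ≤ y × y < h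
  bnd (here refl) = l≤x , x<h
  bnd (there y∈) with ∈-++⁻ A y∈
  ... | inj₁ y∈A = proj₁ (bounded sA y∈A) , <-trans (proj₂ (bounded sA y∈A)) x<h
  ... | inj₂ y∈B = ≤-trans l≤x (<⇒≤ (proj₁ (bounded sB y∈B))) , proj₂ (bounded sB y∈B)
  cmp : ∀ {y} → l ≤ y → y < h → y ∈ x ∷ A ++ B
  cmp {y} l≤y y<h with <-cmp y x
  ... | tri< y<x _ _  = there (∈-++⁺ˡ (complete sA l≤y y<x))
  ... | tri≈ _ refl _ = here refl
  ... | tri> _ _ x<y  = there (∈-++⁺ʳ A (complete sB x<y y<h))

size-bstShape : ∀ w {l h} → Spans l h w → l ≤ h → l + size (bstShape w) ≡ h
size-bstShape = pivot-induction P base pivot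
  where
  P : List ℕ → Set
  P w = ∀ {l h} → Spans l h w → l ≤ h → l + size (bstShape w) ≡ h
  base : P []
  base {l} s l≤h = trans (+-identityʳ l) (≤-antisym l≤h (Spans-[] s))
  pivot : ∀ x w → P (below x w) → P (above x w) → P (x ∷ w)
  pivot x w IHb IHa {l} {h} s l≤h = begin
    l + size (bstShape (x ∷ w))  ≡⟨ cong (λ t → l + size t) (bstShape-∷ x w) ⟩
    l + suc (L + R)              ≡⟨ +-suc l (L + R) ⟩
    suc (l + (L + R))            ≡⟨ cong suc (+-assoc l L R) ⟨
    suc (l + L + R)              ≡⟨ cong (λ k → suc k + R) (IHb (Spans-below s) l≤x) ⟩
    suc x + R                    ≡⟨ IHa (Spans-above s) x<h ⟩
    h                            ∎
    where
    open ≡-Reasoning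
    L = size (bstShape (below x w))
    R = size (bstShape (above x w))
    l≤x = proj₁ (bounded s (here refl))
    x<h = proj₂ (bounded s (here refl))

labelInorder : Tree → ℕ → LTree
labelInorder leaf       l = tip
labelInorder (node a b) l = bin (labelInorder a l) (l + size a) (labelInorder b (suc (l + size a)))

bst-labelInorder : ∀ w {l h} → Spans l h w → bst w ≡ labelInorder (bstShape w) l
bst-labelInorder = pivot-induction P (λ _ → refl) pivot
  where
  P : List ℕ → Set
  P w = ∀ {l h} → Spans l h w → bst w ≡ labelInorder (bstShape w) l
  pivot : ∀ x w → P (below x w) → P (above x w) → P (x ∷ w)
  pivot x w IHb IHa {l} s = begin
    bst (x ∷ w)
      ≡⟨ bst-∷ x w ⟩
    bin (bst (below x w)) x (bst (above x w))
      ≡⟨ cong₂ (λ L R → bin L x R) (IHb (Spans-below s)) (IHa (Spans-above s)) ⟩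
    bin (labelInorder Sb l) x (labelInorder Sa (suc x))
      ≡⟨ cong (λ k → bin (labelInorder Sb l) k (labelInorder Sa (suc k))) l+Sb≡x ⟨
    labelInorder (node Sb Sa) l
      ≡⟨ cong (λ t → labelInorder t l) (bstShape-∷ x w) ⟨
    labelInorder (bstShape (x ∷ w)) l ∎
    where
    open ≡-Reasoning
    Sb = bstShape (below x w)
    Sa = bstShape (above x w)
    l+Sb≡x = size-bstShape (below x w) (Spans-below s) (proj₁ (bounded s (here refl)))

Spans-labelInorder : ∀ t l → Spans l (l + size t) (preorder (labelInorder t l))
Spans-labelInorder leaf l = record
  { bounded = λ ()
  ; complete = λ l≤y y<l+0 → contradiction (≤-trans y<l+0 (≤-reflexive (+-identityʳ l))) (≤⇒≯ l≤y) }
Spans-labelInorder (node a b) l =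
  subst (λ h → Spans l h (preorder (labelInorder (node a b) l))) l+sa+1+sb
    (Spans-join (m≤m+n l (size a)) (m≤m+n (suc (l + size a)) (size b)) (Spans-labelInorder a l) (Spans-labelInorder b (suc (l + size a))))
  where
  l+sa+1+sb : suc (l + size a) + size b ≡ l + size (node a b)
  l+sa+1+sb = sym (trans (+-suc l _) (cong suc (sym (+-assoc l (size a) (size b)))))

module _ {x : ℕ} (A B : List ℕ) (A<x : ∀ {y} → y ∈ A → y < x) (x<B : ∀ {y} → y ∈ B → x < y) where

  below-separated : below x (A ++ B) ≡ A
  below-separated = begin
    below x (A ++ B)        ≡⟨ filter-++ (_<? x) A B ⟩
    below x A ++ below x B  ≡⟨ cong₂ _++_ (filter-all (_<? x) (All.tabulate A<x))
                                          (filter-none (_<? x) (All.tabulate (<⇒≯ ∘ x<B))) ⟩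
    A ++ []                 ≡⟨ ++-identityʳ A ⟩
    A                       ∎
    where open ≡-Reasoning

  above-separated : above x (A ++ B) ≡ B
  above-separated = begin
    above x (A ++ B)        ≡⟨ filter-++ (x <?_) A B ⟩
    above x A ++ above x B  ≡⟨ cong₂ _++_ (filter-none (x <?_) (All.tabulate (<⇒≯ ∘ A<x)))
                                          (filter-all (x <?_) (All.tabulate x<B)) ⟩
    B                       ∎
    where open ≡-Reasoning

bstShape-labelInorder : ∀ t l → bstShape (preorder (labelInorder t l)) ≡ t
bstShape-labelInorder leaf       l = refl
bstShape-labelInorder (node a b) l = begin
  bstShape (k ∷ wa ++ wb)
    ≡⟨ bstShape-∷ k (wa ++ wb) ⟩
  node (bstShape (below k (wa ++ wb))) (bstShape (above k (wa ++ wb)))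
    ≡⟨ cong₂ (λ L R → node (bstShape L) (bstShape R)) (below-separated wa wb wa<k k<wb) (above-separated wa wb wa<k k<wb) ⟩
  node (bstShape wa) (bstShape wb)
    ≡⟨ cong₂ node (bstShape-labelInorder a l) (bstShape-labelInorder b (suc k)) ⟩
  node a b ∎
  where
  open ≡-Reasoning
  k = l + size a
  wa = preorder (labelInorder a l)
  wb = preorder (labelInorder b (suc k))
  wa<k : ∀ {y} → y ∈ wa → y < k
  wa<k = proj₂ ∘ bounded (Spans-labelInorder a l)
  k<wb : ∀ {y} → y ∈ wb → k < y
  k<wb = proj₁ ∘ bounded (Spans-labelInorder b (suc k))

-- Invariance under F₁ and ≡_P̄

bst-deduplicate : ∀ w → bst (F₁ w) ≡ bst w
bst-deduplicate = pivot-induction (λ w → bst (F₁ w) ≡ bst w) refl pivot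
  where
  pivot : ∀ x w → bst (F₁ (below x w)) ≡ bst (below x w) → bst (F₁ (above x w)) ≡ bst (above x w) →
          bst (F₁ (x ∷ w)) ≡ bst (x ∷ w)
  pivot x w IHb IHa = begin
    bst (x ∷ rest)
      ≡⟨ bst-∷ x rest ⟩
    bin (bst (below x rest)) x (bst (above x rest))
      ≡⟨ cong₂ (λ L R → bin L x R) (side (_<? x) (λ z<x x≡z → <-irrefl (sym x≡z) z<x) IHb)
                                     (side (x <?_) (λ x<z x≡z → <-irrefl x≡z x<z) IHa) ⟩
    bin (bst (below x w)) x (bst (above x w))
      ≡⟨ bst-∷ x w ⟨
    bst (x ∷ w) ∎
    where
    open ≡-Reasoning
    rest = filter (¬? ∘ (x ≟_)) (F₁ w)
    side : ∀ {P : Pred ℕ 0ℓ} (P? : Decidable P) → (∀ {z} → P z → x ≢ z) →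
           bst (F₁ (filter P? w)) ≡ bst (filter P? w) → bst (filter P? rest) ≡ bst (filter P? w)
    side P? P⇒≢x IH = trans (cong bst (trans (filter-filter-⊆ P? (¬? ∘ (x ≟_)) P⇒≢x (F₁ w))
                                              (filter-deduplicate _≟_ P? w)))
                            IH

bst-step : ∀ u {a c v} → P̄ u a c v → bst (u ++ a ∷ c ∷ v) ≡ bst (u ++ c ∷ a ∷ v)
bst-step = pivot-induction P (λ { (_ , () , _) }) pivot
  where
  P : List ℕ → Set
  P u = ∀ {a c v} → P̄ u a c v → bst (u ++ a ∷ c ∷ v) ≡ bst (u ++ c ∷ a ∷ v)
  pivot : ∀ y u → P (below y u) → P (above y u) → P (y ∷ u)
  pivot y u IHb IHa {a} {c} {v} (b , b∈y∷u , a≤b , b<c) = begin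
    bst (y ∷ u ++ a ∷ c ∷ v)
      ≡⟨ bst-∷ y (u ++ a ∷ c ∷ v) ⟩
    bin (bst (below y (u ++ a ∷ c ∷ v))) y (bst (above y (u ++ a ∷ c ∷ v)))
      ≡⟨ cong₂ (λ L R → bin L y R) (side (_<? y) IHb below-witness) (side (y <?_) IHa above-witness) ⟩
    bin (bst (below y (u ++ c ∷ a ∷ v))) y (bst (above y (u ++ c ∷ a ∷ v)))
      ≡⟨ bst-∷ y (u ++ c ∷ a ∷ v) ⟨
    bst (y ∷ u ++ c ∷ a ∷ v) ∎
    where
    open ≡-Reasoning
    side : ∀ {Q : Pred ℕ 0ℓ} (Q? : Decidable Q) → P (filter Q? u) →
           (Q a → Q c → P̄ (filter Q? u) a c (filter Q? v)) →
           bst (filter Q? (u ++ a ∷ c ∷ v)) ≡ bst (filter Q? (u ++ c ∷ a ∷ v))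
    side Q? IH witness with Q? a ×-dec Q? c
    ... | yes (qa , qc) = begin
      bst (filter Q? (u ++ a ∷ c ∷ v))          ≡⟨ cong bst (filter-++ Q? u (a ∷ c ∷ v)) ⟩
      bst (filter Q? u ++ filter Q? (a ∷ c ∷ v)) ≡⟨ cong (λ t → bst (filter Q? u ++ t)) (filter-accept₂ Q? v qa qc) ⟩
      bst (filter Q? u ++ a ∷ c ∷ filter Q? v)   ≡⟨ IH (witness qa qc) ⟩
      bst (filter Q? u ++ c ∷ a ∷ filter Q? v)   ≡⟨ cong (λ t → bst (filter Q? u ++ t)) (filter-accept₂ Q? v qc qa) ⟨
      bst (filter Q? u ++ filter Q? (c ∷ a ∷ v)) ≡⟨ cong bst (filter-++ Q? u (c ∷ a ∷ v)) ⟨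
      bst (filter Q? (u ++ c ∷ a ∷ v))          ∎
    ... | no ¬qa×qc = cong bst (begin
      filter Q? (u ++ a ∷ c ∷ v)          ≡⟨ filter-++ Q? u (a ∷ c ∷ v) ⟩
      filter Q? u ++ filter Q? (a ∷ c ∷ v) ≡⟨ cong (filter Q? u ++_) (filter-swap Q? v ¬qa×qc) ⟩
      filter Q? u ++ filter Q? (c ∷ a ∷ v) ≡⟨ filter-++ Q? u (c ∷ a ∷ v) ⟨
      filter Q? (u ++ c ∷ a ∷ v)          ∎)
    below-witness : a < y → c < y → P̄ (below y u) a c (below y v)
    below-witness _ c<y = b , ∈-below-∷ b∈y∷u (<-trans b<c c<y) , a≤b , b<c
    above-witness : y < a → y < c → P̄ (above y u) a c (above y v)
    above-witness y<a _ = b , ∈-above-∷ b∈y∷u (<-≤-trans y<a a≤b) , a≤b , b<c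

bst-≡P̄ : ∀ {x z} → x ≡P̄ z → bst x ≡ bst z
bst-≡P̄ = gfold isEquivalence bst λ { (step u a c v p) → bst-step u p }

-- θ is the preorder reading of the binary search tree

Step-++ˡ : ∀ p {x z} → Step x z → Step (p ++ x) (p ++ z)
Step-++ˡ p (step u a c v (b , b∈u , a≤b<c)) =
  subst₂ Step (++-assoc p u (a ∷ c ∷ v)) (++-assoc p u (c ∷ a ∷ v))
    (step (p ++ u) a c v (b , ∈-++⁺ʳ p b∈u , a≤b<c))

Step-++ʳ : ∀ q {x z} → Step x z → Step (x ++ q) (z ++ q)
Step-++ʳ q (step u a c v p) =
  subst₂ Step (sym (++-assoc u (a ∷ c ∷ v) q)) (sym (++-assoc u (c ∷ a ∷ v) q)) (step u a c (v ++ q) p)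

≡P̄-++ˡ : ∀ p {x z} → x ≡P̄ z → (p ++ x) ≡P̄ (p ++ z)
≡P̄-++ˡ p = gmap (p ++_) (Step-++ˡ p)

≡P̄-++ʳ : ∀ q {x z} → x ≡P̄ z → (x ++ q) ≡P̄ (z ++ q)
≡P̄-++ʳ q = gmap (_++ q) (Step-++ʳ q)

≡P̄-sink : ∀ {y z} p L H → y ∈ p → y < z → (∀ {l} → l ∈ L → l < y) →
          (p ++ z ∷ L ++ H) ≡P̄ (p ++ L ++ z ∷ H)
≡P̄-sink p []      H _   _   _   = ε
≡P̄-sink {y} {z} p (l ∷ L) H y∈p y<z L<y =
  bwd (step p l z (L ++ H) (y , y∈p , <⇒≤ (L<y (here refl)) , y<z)) ◅
  subst₂ _≡P̄_ (++-assoc p [ l ] (z ∷ L ++ H)) (++-assoc p [ l ] (L ++ z ∷ H))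
    (≡P̄-sink (p ++ [ l ]) L H (∈-++⁺ˡ y∈p) y<z (L<y ∘ there))

≡P̄-partition : ∀ {y} p w → y ∈ p → y ∉ w → (p ++ w) ≡P̄ (p ++ below y w ++ above y w)
≡P̄-partition p []      _   _   = ε
≡P̄-partition {y} p (z ∷ w) y∈p y∉z∷w with <-cmp z y
... | tri< z<y _ _ =
  subst₂ _≡P̄_ (++-assoc p [ z ] w)
    (trans (++-assoc p [ z ] (below y w ++ above y w))
           (cong (p ++_) (sym (cong₂ _++_ (below-∷-< z<y) (above-∷-< z<y)))))
    IH
  where IH = ≡P̄-partition (p ++ [ z ]) w (∈-++⁺ˡ y∈p) (y∉z∷w ∘ there)
... | tri≈ _ z≡y _ = contradiction (here (sym z≡y)) y∉z∷w
... | tri> _ _ y<z =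
  subst₂ _≡P̄_ (++-assoc p [ z ] w) (++-assoc p [ z ] (below y w ++ above y w)) IH
  ◅◅ subst ((p ++ z ∷ below y w ++ above y w) ≡P̄_)
       (cong (p ++_) (sym (cong₂ _++_ (below-∷-> y<z) (above-∷-> y<z))))
       (≡P̄-sink p (below y w) (above y w) y∈p y<z (proj₂ ∘ ∈-filter⁻ (_<? y) {xs = w}))
  where IH = ≡P̄-partition (p ++ [ z ]) w (∈-++⁺ˡ y∈p) (y∉z∷w ∘ there)

≡P̄-bstPreorder : ∀ w → Unique w → w ≡P̄ bstPreorder w
≡P̄-bstPreorder = pivot-induction P (λ _ → ε) pivot
  where
  P : List ℕ → Set
  P w = Unique w → w ≡P̄ bstPreorder w
  pivot : ∀ x w → P (below x w) → P (above x w) → P (x ∷ w)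
  pivot x w IHb IHa (x∉w ∷ uw) =
    subst ((x ∷ w) ≡P̄_) (sym (bstPreorder-∷ x w))
      (≡P̄-partition [ x ] w (here refl) (All¬⇒¬Any x∉w)
       ◅◅ ≡P̄-++ˡ [ x ] (≡P̄-++ʳ (above x w) (IHb (Unique.filter⁺ (_<? x) uw)))
       ◅◅ ≡P̄-++ˡ (x ∷ bstPreorder (below x w)) (IHa (Unique.filter⁺ (x <?_) uw)))

≡P̄⇒↭ : ∀ {x z} → x ≡P̄ z → x ↭ z
≡P̄⇒↭ = fold ↭-isEquivalence λ { (step u a c v _) → ++⁺ˡ u (↭-swap a c ↭-refl) }

Unique-resp-≡P̄ : ∀ {x z} → x ≡P̄ z → Unique x → Unique z
Unique-resp-≡P̄ x≡z = PermutationSetoid.Unique-resp-↭ (setoid ℕ) (↭⇒↭ₛ′ isEquivalence (≡P̄⇒↭ x≡z))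

≤lex-trans : ∀ {x y z} → x ≤lex y → y ≤lex z → x ≤lex z
≤lex-trans []≤      _        = []≤
≤lex-trans (<∷ a<b) (<∷ b<c) = <∷ (<-trans a<b b<c)
≤lex-trans (<∷ a<b) (≡∷ _)   = <∷ a<b
≤lex-trans (≡∷ _)   (<∷ b<c) = <∷ b<c
≤lex-trans (≡∷ p)   (≡∷ q)   = ≡∷ (≤lex-trans p q)

≤lex-++ : ∀ {x x′ y y′} → length x ≡ length x′ → x ≤lex x′ → y ≤lex y′ → (x ++ y) ≤lex (x′ ++ y′)
≤lex-++ {x′ = []}    _ []≤      y≤y′ = y≤y′
≤lex-++ {x′ = _ ∷ _} () []≤     _
≤lex-++              _ (<∷ a<b) _    = <∷ a<b
≤lex-++              e (≡∷ x≤x′) y≤y′ = ≡∷ (≤lex-++ (suc-injective e) x≤x′ y≤y′)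

≤lex-insert : ∀ {y} L H w → (∀ {l} → l ∈ L → l < y) → (L ++ H) ≤lex w → (L ++ y ∷ H) ≤lex (y ∷ w)
≤lex-insert []      H w _   L++H≤w = ≡∷ L++H≤w
≤lex-insert (l ∷ L) H w L<y _      = <∷ (L<y (here refl))

partition-≤lex : ∀ {x} w → x ∉ w → (below x w ++ above x w) ≤lex w
partition-≤lex []      _     = []≤
partition-≤lex {x} (y ∷ w) x∉y∷w with <-cmp y x
... | tri< y<x _ _ =
  subst (_≤lex (y ∷ w)) (sym (cong₂ _++_ (below-∷-< y<x) (above-∷-< y<x))) (≡∷ IH)
  where IH = partition-≤lex w (x∉y∷w ∘ there)
... | tri≈ _ y≡x _ = contradiction (here (sym y≡x)) x∉y∷w
... | tri> _ _ x<y =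
  subst (_≤lex (y ∷ w)) (sym (cong₂ _++_ (below-∷-> x<y) (above-∷-> x<y)))
    (≤lex-insert (below x w) (above x w) w (λ l∈ → <-trans (proj₂ (∈-filter⁻ (_<? x) {xs = w} l∈)) x<y) IH)
  where IH = partition-≤lex w (x∉y∷w ∘ there)

bstPreorder-≤lex : ∀ w → Unique w → bstPreorder w ≤lex w
bstPreorder-≤lex = pivot-induction P (λ _ → []≤) pivot
  where
  P : List ℕ → Set
  P w = Unique w → bstPreorder w ≤lex w
  pivot : ∀ x w → P (below x w) → P (above x w) → P (x ∷ w)
  pivot x w IHb IHa (x∉w ∷ uw) =
    subst (_≤lex (x ∷ w)) (sym (bstPreorder-∷ x w))
      (≡∷ (≤lex-trans (≤lex-++ same-length (IHb ub) (IHa ua)) (partition-≤lex w (All¬⇒¬Any x∉w))))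
    where
    ub = Unique.filter⁺ (_<? x) uw
    ua = Unique.filter⁺ (x <?_) uw
    same-length : length (bstPreorder (below x w)) ≡ length (below x w)
    same-length = sym (↭-length (≡P̄⇒↭ (≡P̄-bstPreorder (below x w) ub)))

IsTheta-bstPreorder : ∀ w → Unique w → IsTheta w (bstPreorder w)
IsTheta-bstPreorder w uw = symmetric Step (≡P̄-bstPreorder w uw) , minimal
  where
  minimal : ∀ z → z ≡P̄ w → bstPreorder w ≤lex z
  minimal z z≡w = subst (_≤lex z) (cong preorder (bst-≡P̄ z≡w))
                    (bstPreorder-≤lex z (Unique-resp-≡P̄ (symmetric Step z≡w) uw))

Packed⇒Spans : ∀ {n u} → Packed n u → Spans 1 (suc n) u
Packed⇒Spans (bnd , cmp) = record
  { bounded  = λ y∈ → let 1≤y , y≤n = bnd _ y∈ in 1≤y , s≤s y≤n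
  ; complete = λ 1≤y y<1+n → cmp _ 1≤y (s≤s⁻¹ y<1+n)
  }

Spans⇒Packed : ∀ {n u} → Spans 1 (suc n) u → Packed n u
Spans⇒Packed s = (λ _ y∈ → let 1≤y , y<1+n = bounded s y∈ in 1≤y , s≤s⁻¹ y<1+n)
               , (λ _ 1≤y y≤n → complete s 1≤y (s≤s y≤n))

Spans-F₁ : ∀ {l h w} → Spans l h w → Spans l h (F₁ w)
Spans-F₁ {w = w} s = record
  { bounded  = bounded s ∘ ∈-deduplicate⁻ _≟_ w
  ; complete = λ l≤y y<h → ∈-deduplicate⁺ _≟_ (complete s l≤y y<h)
  }

bstShape-F₁ : ∀ w → bstShape (F₁ w) ≡ bstShape w
bstShape-F₁ w = cong shape (bst-deduplicate w)

size-bstShape-Packed : ∀ {n u} → Packed n u → size (bstShape u) ≡ n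
size-bstShape-Packed {u = u} pu = suc-injective (size-bstShape u (Packed⇒Spans pu) (s≤s z≤n))

≈⇒bstShape≡ : ∀ {u v} → u ≈ v → bstShape u ≡ bstShape v
≈⇒bstShape≡ {u} {v} (w , (w≡F₁u , _) , (w≡F₁v , _)) = cong shape (begin
  bst u      ≡⟨ bst-deduplicate u ⟨
  bst (F₁ u) ≡⟨ bst-≡P̄ w≡F₁u ⟨
  bst w      ≡⟨ bst-≡P̄ w≡F₁v ⟩
  bst (F₁ v) ≡⟨ bst-deduplicate v ⟩
  bst v      ∎)
  where open ≡-Reasoning

bstPreorder-F₁-Packed : ∀ {n u} → Packed n u → bstPreorder (F₁ u) ≡ preorder (labelInorder (bstShape u) 1)
bstPreorder-F₁-Packed {u = u} pu = cong preorder (begin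
  bst (F₁ u)                           ≡⟨ bst-labelInorder (F₁ u) (Spans-F₁ (Packed⇒Spans pu)) ⟩
  labelInorder (bstShape (F₁ u)) 1     ≡⟨ cong (λ t → labelInorder t 1) (bstShape-F₁ u) ⟩
  labelInorder (bstShape u) 1          ∎)
  where open ≡-Reasoning

bstShape≡⇒≈ : ∀ {n u v} → Packed n u → Packed n v → bstShape u ≡ bstShape v → u ≈ v
bstShape≡⇒≈ {u = u} {v} pu pv u~v =
  bstPreorder (F₁ u) , IsTheta-bstPreorder (F₁ u) (deduplicate-! _≟_ u) ,
  subst (IsTheta (F₁ v)) same-preorder (IsTheta-bstPreorder (F₁ v) (deduplicate-! _≟_ v))
  where
  same-preorder : bstPreorder (F₁ v) ≡ bstPreorder (F₁ u)
  same-preorder = begin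
    bstPreorder (F₁ v)                       ≡⟨ bstPreorder-F₁-Packed pv ⟩
    preorder (labelInorder (bstShape v) 1)   ≡⟨ cong (λ t → preorder (labelInorder t 1)) u~v ⟨
    preorder (labelInorder (bstShape u) 1)   ≡⟨ bstPreorder-F₁-Packed pu ⟨
    bstPreorder (F₁ u)                       ∎
    where open ≡-Reasoning

-- Compatibility with the partial compositions

StrictlyMonotone : (ℕ → ℕ) → Set
StrictlyMonotone g = g Preserves _<_ ⟶ _<_

strictlyMonotone-< : ∀ {g} → StrictlyMonotone g → ∀ a b → g a < g b ⇔ a < b
strictlyMonotone-< {g} mono a b = mk⇔ reflect mono
  where
  reflect : g a < g b → a < b
  reflect ga<gb with <-cmp a b
  ... | tri< a<b _ _  = a<b
  ... | tri≈ _ refl _ = contradiction ga<gb (<-irrefl refl)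
  ... | tri> _ _ b<a  = contradiction ga<gb (<-asym (mono b<a))

bstShape-map : ∀ {g} → StrictlyMonotone g → ∀ w → bstShape (map g w) ≡ bstShape w
bstShape-map {g} mono = pivot-induction (λ w → bstShape (map g w) ≡ bstShape w) refl pivot
  where
  pivot : ∀ x w → bstShape (map g (below x w)) ≡ bstShape (below x w) →
          bstShape (map g (above x w)) ≡ bstShape (above x w) → bstShape (map g (x ∷ w)) ≡ bstShape (x ∷ w)
  pivot x w IHb IHa = begin
    bstShape (g x ∷ map g w)
      ≡⟨ bstShape-∷ (g x) (map g w) ⟩
    node (bstShape (below (g x) (map g w))) (bstShape (above (g x) (map g w)))
      ≡⟨ cong₂ (λ L R → node (bstShape L) (bstShape R))
           (filter-map (_<? g x) (_<? x) g (λ y → strictlyMonotone-< mono y x) w)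
           (filter-map (g x <?_) (x <?_) g (strictlyMonotone-< mono x) w) ⟩
    node (bstShape (map g (below x w))) (bstShape (map g (above x w)))
      ≡⟨ cong₂ node IHb IHa ⟩
    node (bstShape (below x w)) (bstShape (above x w))
      ≡⟨ bstShape-∷ x w ⟨
    bstShape (x ∷ w) ∎
    where open ≡-Reasoning

bst-++-redundant : ∀ q {W} → (∀ {z} → z ∈ W → z ∈ q) → bst (q ++ W) ≡ bst q
bst-++-redundant = pivot-induction P base pivot
  where
  P : List ℕ → Set
  P q = ∀ {W} → (∀ {z} → z ∈ W → z ∈ q) → bst (q ++ W) ≡ bst q
  base : P []
  base {[]}    _    = refl
  base {_ ∷ _} W⊆[] = contradiction (W⊆[] (here refl)) ¬Any[]
  pivot : ∀ y q → P (below y q) → P (above y q) → P (y ∷ q)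
  pivot y q IHb IHa {W} W⊆y∷q = begin
    bst (y ∷ q ++ W)
      ≡⟨ bst-∷ y (q ++ W) ⟩
    bin (bst (below y (q ++ W))) y (bst (above y (q ++ W)))
      ≡⟨ cong₂ (λ L R → bin (bst L) y (bst R)) (filter-++ (_<? y) q W) (filter-++ (y <?_) q W) ⟩
    bin (bst (below y q ++ below y W)) y (bst (above y q ++ above y W))
      ≡⟨ cong₂ (λ L R → bin L y R) (IHb below⊆) (IHa above⊆) ⟩
    bin (bst (below y q)) y (bst (above y q))
      ≡⟨ bst-∷ y q ⟨
    bst (y ∷ q) ∎
    where
    open ≡-Reasoning
    below⊆ : ∀ {z} → z ∈ below y W → z ∈ below y q
    below⊆ z∈ = let z∈W , z<y = ∈-filter⁻ (_<? y) {xs = W} z∈ in ∈-below-∷ (W⊆y∷q z∈W) z<y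
    above⊆ : ∀ {z} → z ∈ above y W → z ∈ above y q
    above⊆ z∈ = let z∈W , y<z = ∈-filter⁻ (y <?_) {xs = W} z∈ in ∈-above-∷ (W⊆y∷q z∈W) y<z

bstShape-∷-++ : ∀ y p W → bstShape (y ∷ p ++ W) ≡ node (bstShape (below y p ++ below y W)) (bstShape (above y p ++ above y W))
bstShape-∷-++ y p W = trans (bstShape-∷ y (p ++ W))
  (cong₂ (λ L R → node (bstShape L) (bstShape R)) (filter-++ (_<? y) p W) (filter-++ (y <?_) p W))

bstShape-graftL : ∀ p {a W} → (∀ {z} → z ∈ p → a ≤ z) → (∀ {z} → z ∈ W → z < a ⊎ z ∈ p) →
                  bstShape (p ++ W) ≡ graftL (bstShape p) (bstShape (below a W))
bstShape-graftL = pivot-induction P base pivot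
  where
  P : List ℕ → Set
  P p = ∀ {a W} → (∀ {z} → z ∈ p → a ≤ z) → (∀ {z} → z ∈ W → z < a ⊎ z ∈ p) →
        bstShape (p ++ W) ≡ graftL (bstShape p) (bstShape (below a W))
  base : P []
  base {a} {W} _ W⊆ = cong bstShape (sym (filter-all (_<? a) (All.tabulate (fromInj₁ (λ ()) ∘ W⊆))))
  pivot : ∀ y p → P (below y p) → P (above y p) → P (y ∷ p)
  pivot y p IHb _ {a} {W} a≤p W⊆ = begin
    bstShape (y ∷ p ++ W)
      ≡⟨ bstShape-∷-++ y p W ⟩
    node (bstShape (below y p ++ below y W)) (bstShape (above y p ++ above y W))
      ≡⟨ cong₂ node (IHb (a≤p ∘ there ∘ proj₁ ∘ ∈-filter⁻ (_<? y)) below⊆)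
                    (cong shape (bst-++-redundant (above y p) above⊆)) ⟩
    node (graftL (bstShape (below y p)) (bstShape (below a (below y W)))) (bstShape (above y p))
      ≡⟨ cong (λ t → node (graftL (bstShape (below y p)) (bstShape t)) (bstShape (above y p)))
              (filter-filter-⊆ (_<? a) (_<? y) (λ z<a → <-≤-trans z<a a≤y) W) ⟩
    graftL (node (bstShape (below y p)) (bstShape (above y p))) (bstShape (below a W))
      ≡⟨ cong (λ t → graftL t (bstShape (below a W))) (bstShape-∷ y p) ⟨
    graftL (bstShape (y ∷ p)) (bstShape (below a W)) ∎
    where
    open ≡-Reasoning
    a≤y = a≤p (here refl)
    below⊆ : ∀ {z} → z ∈ below y W → z < a ⊎ z ∈ below y p
    below⊆ z∈ with ∈-filter⁻ (_<? y) {xs = W} z∈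
    ... | z∈W , z<y with W⊆ z∈W
    ...   | inj₁ z<a   = inj₁ z<a
    ...   | inj₂ z∈y∷p = inj₂ (∈-below-∷ z∈y∷p z<y)
    above⊆ : ∀ {z} → z ∈ above y W → z ∈ above y p
    above⊆ z∈ with ∈-filter⁻ (y <?_) {xs = W} z∈
    ... | z∈W , y<z with W⊆ z∈W
    ...   | inj₁ z<a   = contradiction (≤-<-trans a≤y y<z) (<⇒≯ z<a)
    ...   | inj₂ z∈y∷p = ∈-above-∷ z∈y∷p y<z

bstShape-graftR : ∀ p {b W} → (∀ {z} → z ∈ p → z < b) → (∀ {z} → z ∈ W → b ≤ z ⊎ z ∈ p) →
                  bstShape (p ++ W) ≡ graftR (bstShape p) (bstShape (atLeast b W))
bstShape-graftR = pivot-induction P base pivot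
  where
  P : List ℕ → Set
  P p = ∀ {b W} → (∀ {z} → z ∈ p → z < b) → (∀ {z} → z ∈ W → b ≤ z ⊎ z ∈ p) →
        bstShape (p ++ W) ≡ graftR (bstShape p) (bstShape (atLeast b W))
  base : P []
  base {b} {W} _ W⊆ = cong bstShape (sym (filter-all (b ≤?_) (All.tabulate (fromInj₁ (λ ()) ∘ W⊆))))
  pivot : ∀ y p → P (below y p) → P (above y p) → P (y ∷ p)
  pivot y p _ IHa {b} {W} p<b W⊆ = begin
    bstShape (y ∷ p ++ W)
      ≡⟨ bstShape-∷-++ y p W ⟩
    node (bstShape (below y p ++ below y W)) (bstShape (above y p ++ above y W))
      ≡⟨ cong₂ node (cong shape (bst-++-redundant (below y p) below⊆))
                    (IHa (p<b ∘ there ∘ proj₁ ∘ ∈-filter⁻ (y <?_)) above⊆) ⟩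
    node (bstShape (below y p)) (graftR (bstShape (above y p)) (bstShape (atLeast b (above y W))))
      ≡⟨ cong (λ t → node (bstShape (below y p)) (graftR (bstShape (above y p)) (bstShape t)))
              (filter-filter-⊆ (b ≤?_) (y <?_) (<-≤-trans y<b) W) ⟩
    graftR (node (bstShape (below y p)) (bstShape (above y p))) (bstShape (atLeast b W))
      ≡⟨ cong (λ t → graftR t (bstShape (atLeast b W))) (bstShape-∷ y p) ⟨
    graftR (bstShape (y ∷ p)) (bstShape (atLeast b W)) ∎
    where
    open ≡-Reasoning
    y<b = p<b (here refl)
    below⊆ : ∀ {z} → z ∈ below y W → z ∈ below y p
    below⊆ z∈ with ∈-filter⁻ (_<? y) {xs = W} z∈
    ... | z∈W , z<y with W⊆ z∈W
    ...   | inj₁ b≤z   = contradiction (<-≤-trans z<y (<⇒≤ y<b)) (≤⇒≯ b≤z)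
    ...   | inj₂ z∈y∷p = ∈-below-∷ z∈y∷p z<y
    above⊆ : ∀ {z} → z ∈ above y W → b ≤ z ⊎ z ∈ above y p
    above⊆ z∈ with ∈-filter⁻ (y <?_) {xs = W} z∈
    ... | z∈W , y<z with W⊆ z∈W
    ...   | inj₁ b≤z   = inj₁ b≤z
    ...   | inj₂ z∈y∷p = inj₂ (∈-above-∷ z∈y∷p y<z)

bstShape-block : ∀ p {a b W} → p ≢ [] → (∀ {z} → z ∈ p → a ≤ z × z < b) →
                 (∀ {z} → z ∈ W → z < a ⊎ b ≤ z ⊎ z ∈ p) →
                 bstShape (p ++ W) ≡ graftR (graftL (bstShape p) (bstShape (below a W))) (bstShape (atLeast b W))
bstShape-block []      []≢[] _ _ = contradiction refl []≢[]
bstShape-block (y ∷ p) {a} {b} {W} _ p⊆ W⊆ = begin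
  bstShape (y ∷ p ++ W)
    ≡⟨ bstShape-∷-++ y p W ⟩
  node (bstShape (below y p ++ below y W)) (bstShape (above y p ++ above y W))
    ≡⟨ cong₂ node (bstShape-graftL (below y p) (proj₁ ∘ p⊆ ∘ there ∘ proj₁ ∘ ∈-filter⁻ (_<? y)) below⊆)
                  (bstShape-graftR (above y p) (proj₂ ∘ p⊆ ∘ there ∘ proj₁ ∘ ∈-filter⁻ (y <?_)) above⊆) ⟩
  node (graftL Sb (bstShape (below a (below y W)))) (graftR Sa (bstShape (atLeast b (above y W))))
    ≡⟨ cong₂ (λ L R → node (graftL Sb (bstShape L)) (graftR Sa (bstShape R)))
             (filter-filter-⊆ (_<? a) (_<? y) (λ z<a → <-≤-trans z<a a≤y) W)
             (filter-filter-⊆ (b ≤?_) (y <?_) (<-≤-trans y<b) W) ⟩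
  graftR (graftL (node Sb Sa) (bstShape (below a W))) (bstShape (atLeast b W))
    ≡⟨ cong (λ t → graftR (graftL t (bstShape (below a W))) (bstShape (atLeast b W))) (bstShape-∷ y p) ⟨
  graftR (graftL (bstShape (y ∷ p)) (bstShape (below a W))) (bstShape (atLeast b W)) ∎
  where
  open ≡-Reasoning
  Sb = bstShape (below y p)
  Sa = bstShape (above y p)
  a≤y = proj₁ (p⊆ (here refl))
  y<b = proj₂ (p⊆ (here refl))
  below⊆ : ∀ {z} → z ∈ below y W → z < a ⊎ z ∈ below y p
  below⊆ z∈ with ∈-filter⁻ (_<? y) {xs = W} z∈
  ... | z∈W , z<y with W⊆ z∈W
  ...   | inj₁ z<a          = inj₁ z<a
  ...   | inj₂ (inj₁ b≤z)   = contradiction (<-trans z<y y<b) (≤⇒≯ b≤z)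
  ...   | inj₂ (inj₂ z∈y∷p) = inj₂ (∈-below-∷ z∈y∷p z<y)
  above⊆ : ∀ {z} → z ∈ above y W → b ≤ z ⊎ z ∈ above y p
  above⊆ z∈ with ∈-filter⁻ (y <?_) {xs = W} z∈
  ... | z∈W , y<z with W⊆ z∈W
  ...   | inj₁ z<a          = contradiction (≤-<-trans a≤y y<z) (<⇒≯ z<a)
  ...   | inj₂ (inj₁ b≤z)   = inj₁ b≤z
  ...   | inj₂ (inj₂ z∈y∷p) = inj₂ (∈-above-∷ z∈y∷p y<z)

compT-left : ∀ {j} L R s → j ≤ size L → compT j (node L R) s ≡ node (compT j L s) R
compT-left {j} L R s j≤L with j ≤ᵇ size L | ≤⇒≤ᵇ j≤L
... | true | _ = refl

compT-root : ∀ L R s → compT (suc (size L)) (node L R) s ≡ graftR (graftL s L) R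
compT-root L R s with suc (size L) ≤ᵇ size L | ≤ᵇ⇒≤ (suc (size L)) (size L)
... | true  | 1+L≤L = contradiction (1+L≤L _) (<-irrefl refl)
... | false | _ with size L ≡ᵇ size L | ≡⇒≡ᵇ (size L) (size L) refl
...   | true | _ = refl

compT-right : ∀ L R s j → compT (suc (size L) + suc j) (node L R) s ≡ node L (compT (suc j) R s)
compT-right L R s j with suc (size L) + suc j ≤ᵇ size L | ≤ᵇ⇒≤ (suc (size L) + suc j) (size L)
... | true  | ≤L = contradiction (≤L _) (<⇒≱ (m≤m+n (suc (size L)) (suc j)))
... | false | _ with size L + suc j ≡ᵇ size L | ≡ᵇ⇒≡ (size L + suc j) (size L)
...   | true  | eq = contradiction (eq _) (m+1+n≢m (size L))
...   | false | _ = cong (λ k → node L (compT k R s)) (m+n∸m≡n (suc (size L)) (suc j))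

module Substitution (i d : ℕ) (V : List ℕ) where

  σ : ℕ → List ℕ
  σ y with <-cmp y i
  ... | tri< _ _ _ = [ y ]
  ... | tri≈ _ _ _ = V
  ... | tri> _ _ _ = [ y + d ]

  substitute : List ℕ → List ℕ
  substitute = concatMap σ

  σ-< : ∀ {y} → y < i → σ y ≡ [ y ]
  σ-< {y} y<i with <-cmp y i
  ... | tri< _ _ _     = refl
  ... | tri≈ y≮i _ _   = contradiction y<i y≮i
  ... | tri> y≮i _ _   = contradiction y<i y≮i

  σ-≡ : σ i ≡ V
  σ-≡ with <-cmp i i
  ... | tri< _ i≢i _   = contradiction refl i≢i
  ... | tri≈ _ _ _     = refl
  ... | tri> _ i≢i _   = contradiction refl i≢i

  σ-> : ∀ {y} → i < y → σ y ≡ [ y + d ]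
  σ-> {y} i<y with <-cmp y i
  ... | tri< _ _ y≯i   = contradiction i<y y≯i
  ... | tri≈ _ _ y≯i   = contradiction i<y y≯i
  ... | tri> _ _ _     = refl

  ∈-σ : ∀ y {z} → z ∈ σ y → (y < i × z ≡ y) ⊎ (y ≡ i × z ∈ V) ⊎ (i < y × z ≡ y + d)
  ∈-σ y z∈ with <-cmp y i | z∈
  ... | tri< y<i _ _ | here refl = inj₁ (y<i , refl)
  ... | tri≈ _ y≡i _ | z∈V       = inj₂ (inj₁ (y≡i , z∈V))
  ... | tri> _ _ i<y | here refl = inj₂ (inj₂ (i<y , refl))

  ∈-substitute : ∀ u {z} → z ∈ substitute u → z < i ⊎ suc (i + d) ≤ z ⊎ z ∈ V
  ∈-substitute u z∈ with satisfied (∈-concatMap⁻ σ {xs = u} z∈)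
  ... | y , z∈σy with ∈-σ y z∈σy
  ...   | inj₁ (y<i , refl)        = inj₁ y<i
  ...   | inj₂ (inj₁ (_ , z∈V))    = inj₂ (inj₂ z∈V)
  ...   | inj₂ (inj₂ (i<y , refl)) = inj₂ (inj₁ (+-monoˡ-≤ d i<y))

  substitute-fixed : ∀ w → (∀ {y} → y ∈ w → y < i) → substitute w ≡ w
  substitute-fixed []      _   = refl
  substitute-fixed (y ∷ w) w<i = cong₂ _++_ (σ-< (w<i (here refl))) (substitute-fixed w (w<i ∘ there))

  substitute-shifted : ∀ w → (∀ {y} → y ∈ w → i < y) → substitute w ≡ map (_+ d) w
  substitute-shifted []      _   = refl
  substitute-shifted (y ∷ w) i<w = cong₂ _++_ (σ-> (i<w (here refl))) (substitute-shifted w (i<w ∘ there))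

  filter-substitute : ∀ {P Q : Pred ℕ 0ℓ} (P? : Decidable P) (Q? : Decidable Q) →
                      (∀ {y} → y < i → P y ⇔ Q y) → (∀ {z} → z ∈ V → P z ⇔ Q i) →
                      (∀ {y} → i < y → P (y + d) ⇔ Q y) →
                      ∀ u → filter P? (substitute u) ≡ substitute (filter Q? u)
  filter-substitute {P} {Q} P? Q? fixed replaced shifted = filter-concatMap P? Q? σ letter
    where
    letter : ∀ y {z} → z ∈ σ y → P z ⇔ Q y
    letter y z∈ with ∈-σ y z∈
    ... | inj₁ (y<i , refl)         = fixed y<i
    ... | inj₂ (inj₁ (refl , z∈V))  = replaced z∈V
    ... | inj₂ (inj₂ (i<y , refl))  = shifted i<y

  module _ (V≢[] : V ≢ []) (V⊆ : ∀ {z} → z ∈ V → i ≤ z × z ≤ i + d) where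

    private
      both : ∀ {A B : Set} → A → B → A ⇔ B
      both a b = mk⇔ (λ _ → b) (λ _ → a)

      neither : ∀ {A B : Set} → ¬ A → ¬ B → A ⇔ B
      neither ¬a ¬b = mk⇔ (⊥-elim ∘ ¬a) (⊥-elim ∘ ¬b)

      +d-< : ∀ a b → a + d < b + d ⇔ a < b
      +d-< = strictlyMonotone-< (+-monoˡ-< d)

    below-substitute : ∀ {t} → t ≤ i → ∀ u → below t (substitute u) ≡ below t u
    below-substitute {t} t≤i u = begin
      below t (substitute u)  ≡⟨ filter-substitute (_<? t) (_<? t) (λ _ → mk⇔ id id) replaced shifted u ⟩
      substitute (below t u)  ≡⟨ substitute-fixed (below t u) (λ y∈ → <-≤-trans (proj₂ (∈-filter⁻ (_<? t) {xs = u} y∈)) t≤i) ⟩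
      below t u               ∎
      where
      open ≡-Reasoning
      replaced : ∀ {z} → z ∈ V → z < t ⇔ i < t
      replaced z∈V = neither (≤⇒≯ (≤-trans t≤i (proj₁ (V⊆ z∈V)))) (≤⇒≯ t≤i)
      shifted : ∀ {y} → i < y → y + d < t ⇔ y < t
      shifted i<y = neither (≤⇒≯ (≤-trans (≤-trans t≤i (<⇒≤ i<y)) (m≤m+n _ d))) (≤⇒≯ (≤-trans t≤i (<⇒≤ i<y)))

    above-substitute : ∀ {x} → x < i → ∀ u → above x (substitute u) ≡ substitute (above x u)
    above-substitute {x} x<i = filter-substitute (x <?_) (x <?_) (λ _ → mk⇔ id id)
      (λ z∈V → both (<-≤-trans x<i (proj₁ (V⊆ z∈V))) x<i)
      (λ i<y → both (<-≤-trans (<-trans x<i i<y) (m≤m+n _ d)) (<-trans x<i i<y))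

    below-substitute-shifted : ∀ {x} → i < x → ∀ u → below (x + d) (substitute u) ≡ substitute (below x u)
    below-substitute-shifted {x} i<x = filter-substitute (_<? x + d) (_<? x)
      (λ y<i → both (<-≤-trans (<-trans y<i i<x) (m≤m+n x d)) (<-trans y<i i<x))
      (λ z∈V → both (≤-<-trans (proj₂ (V⊆ z∈V)) (+-monoˡ-< d i<x)) i<x)
      (λ {y} _ → +d-< y x)

    above-substitute-shifted : ∀ {x} → i ≤ x → ∀ u → above (x + d) (substitute u) ≡ substitute (above x u)
    above-substitute-shifted {x} i≤x = filter-substitute (x + d <?_) (x <?_)
      (λ y<i → neither (≤⇒≯ (≤-trans (<⇒≤ (<-≤-trans y<i i≤x)) (m≤m+n x d))) (≤⇒≯ (<⇒≤ (<-≤-trans y<i i≤x))))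
      (λ z∈V → neither (≤⇒≯ (≤-trans (proj₂ (V⊆ z∈V)) (+-monoˡ-≤ d i≤x))) (≤⇒≯ i≤x))
      (λ {y} _ → +d-< x y)

    bstShape-substitute-above : ∀ {x} → i ≤ x → ∀ u → bstShape (substitute (above x u)) ≡ bstShape (above x u)
    bstShape-substitute-above {x} i≤x u = begin
      bstShape (substitute (above x u))   ≡⟨ cong bstShape (substitute-shifted (above x u) i<above) ⟩
      bstShape (map (_+ d) (above x u))   ≡⟨ bstShape-map (+-monoˡ-< d) (above x u) ⟩
      bstShape (above x u)                ∎
      where
      open ≡-Reasoning
      i<above : ∀ {y} → y ∈ above x u → i < y
      i<above y∈ = ≤-<-trans i≤x (proj₂ (∈-filter⁻ (x <?_) {xs = u} y∈))

    module _ {x w l k} (l+k≡i : l + k ≡ i) (l+Sb≡x : l + size (bstShape (below x w)) ≡ x) where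

      private
        Sb = bstShape (below x w)
        Sa = bstShape (above x w)
        Sv = bstShape V
        open ≡-Reasoning

      bstShape-substitute-< : x < i → bstShape (substitute (above x w)) ≡ compT (suc (i ∸ suc x)) Sa Sv →
                              bstShape (substitute (x ∷ w)) ≡ compT (suc k) (bstShape (x ∷ w)) Sv
      bstShape-substitute-< x<i IH = begin
        bstShape (σ x ++ substitute w)
          ≡⟨ cong (λ t → bstShape (t ++ substitute w)) (σ-< x<i) ⟩
        bstShape (x ∷ substitute w)
          ≡⟨ bstShape-∷ x (substitute w) ⟩
        node (bstShape (below x (substitute w))) (bstShape (above x (substitute w)))
          ≡⟨ cong₂ (λ A B → node (bstShape A) (bstShape B)) (below-substitute (<⇒≤ x<i) w) (above-substitute x<i w) ⟩
        node Sb (bstShape (substitute (above x w)))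
          ≡⟨ cong (node Sb) IH ⟩
        node Sb (compT (suc j) Sa Sv)
          ≡⟨ compT-right Sb Sa Sv j ⟨
        compT (suc (size Sb) + suc j) (node Sb Sa) Sv
          ≡⟨ cong (λ k → compT (suc k) (node Sb Sa) Sv) k≡Sb+1+j ⟨
        compT (suc k) (node Sb Sa) Sv
          ≡⟨ cong (λ t → compT (suc k) t Sv) (bstShape-∷ x w) ⟨
        compT (suc k) (bstShape (x ∷ w)) Sv ∎
        where
        j = i ∸ suc x
        k≡Sb+1+j : k ≡ size Sb + suc j
        k≡Sb+1+j = +-cancelˡ-≡ l k (size Sb + suc j) (begin
          l + k                 ≡⟨ l+k≡i ⟩
          i                     ≡⟨ m+[n∸m]≡n x<i ⟨
          suc x + j             ≡⟨ +-suc x j ⟨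
          x + suc j             ≡⟨ cong (_+ suc j) l+Sb≡x ⟨
          l + size Sb + suc j   ≡⟨ +-assoc l (size Sb) (suc j) ⟩
          l + (size Sb + suc j) ∎)

      bstShape-substitute-> : i < x → bstShape (substitute (below x w)) ≡ compT (suc k) Sb Sv →
                              bstShape (substitute (x ∷ w)) ≡ compT (suc k) (bstShape (x ∷ w)) Sv
      bstShape-substitute-> i<x IH = begin
        bstShape (σ x ++ substitute w)
          ≡⟨ cong (λ t → bstShape (t ++ substitute w)) (σ-> i<x) ⟩
        bstShape (x + d ∷ substitute w)
          ≡⟨ bstShape-∷ (x + d) (substitute w) ⟩
        node (bstShape (below (x + d) (substitute w))) (bstShape (above (x + d) (substitute w)))
          ≡⟨ cong₂ (λ A B → node (bstShape A) (bstShape B)) (below-substitute-shifted i<x w)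
                                                           (above-substitute-shifted (<⇒≤ i<x) w) ⟩
        node (bstShape (substitute (below x w))) (bstShape (substitute (above x w)))
          ≡⟨ cong₂ node IH (bstShape-substitute-above (<⇒≤ i<x) w) ⟩
        node (compT (suc k) Sb Sv) Sa
          ≡⟨ compT-left Sb Sa Sv k<Sb ⟨
        compT (suc k) (node Sb Sa) Sv
          ≡⟨ cong (λ t → compT (suc k) t Sv) (bstShape-∷ x w) ⟨
        compT (suc k) (bstShape (x ∷ w)) Sv ∎
        where
        k<Sb : k < size Sb
        k<Sb = +-cancelˡ-< l k (size Sb) (subst₂ _<_ (sym l+k≡i) (sym l+Sb≡x) i<x)

      bstShape-substitute-≡ : x ≡ i → bstShape (substitute (x ∷ w)) ≡ compT (suc k) (bstShape (x ∷ w)) Sv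
      bstShape-substitute-≡ refl = begin
        bstShape (σ x ++ substitute w)
          ≡⟨ cong (λ t → bstShape (t ++ substitute w)) σ-≡ ⟩
        bstShape (V ++ substitute w)
          ≡⟨ bstShape-block V V≢[] V-bounds (∈-substitute w) ⟩
        -- atLeast (suc (x + d)) is above (x + d) by definition of _<?_.
        graftR (graftL Sv (bstShape (below x (substitute w)))) (bstShape (above (x + d) (substitute w)))
          ≡⟨ cong₂ (λ A B → graftR (graftL Sv (bstShape A)) (bstShape B)) (below-substitute ≤-refl w)
                                                                          (above-substitute-shifted ≤-refl w) ⟩
        graftR (graftL Sv Sb) (bstShape (substitute (above x w)))
          ≡⟨ cong (graftR (graftL Sv Sb)) (bstShape-substitute-above ≤-refl w) ⟩
        graftR (graftL Sv Sb) Sa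
          ≡⟨ compT-root Sb Sa Sv ⟨
        compT (suc (size Sb)) (node Sb Sa) Sv
          ≡⟨ cong (λ k → compT (suc k) (node Sb Sa) Sv) (+-cancelˡ-≡ l k (size Sb) (trans l+k≡i (sym l+Sb≡x))) ⟨
        compT (suc k) (node Sb Sa) Sv
          ≡⟨ cong (λ t → compT (suc k) t Sv) (bstShape-∷ x w) ⟨
        compT (suc k) (bstShape (x ∷ w)) Sv ∎
        where
        V-bounds : ∀ {z} → z ∈ V → x ≤ z × z < suc (x + d)
        V-bounds z∈V = proj₁ (V⊆ z∈V) , s≤s (proj₂ (V⊆ z∈V))

    -- l + k ≡ i says that i is the (suc k)-th letter of [l, h), i.e. the (suc k)-th node in in-order.
    bstShape-substitute : ∀ u {l h k} → Spans l h u → l + k ≡ i → i < h →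
                          bstShape (substitute u) ≡ compT (suc k) (bstShape u) (bstShape V)
    bstShape-substitute = pivot-induction P base pivot
      where
      P : List ℕ → Set
      P u = ∀ {l h k} → Spans l h u → l + k ≡ i → i < h →
            bstShape (substitute u) ≡ compT (suc k) (bstShape u) (bstShape V)
      base : P []
      base {l} {k = k} s l+k≡i i<h = contradiction (complete s (subst (l ≤_) l+k≡i (m≤m+n l k)) i<h) ¬Any[]
      pivot : ∀ x w → P (below x w) → P (above x w) → P (x ∷ w)
      pivot x w IHb IHa {l} {h} {k} s l+k≡i i<h = by-comparison (<-cmp x i)
        where
        l+Sb≡x = size-bstShape (below x w) (Spans-below s) (proj₁ (bounded s (here refl)))
        by-comparison : Tri (x < i) (x ≡ i) (i < x) →
                        bstShape (substitute (x ∷ w)) ≡ compT (suc k) (bstShape (x ∷ w)) (bstShape V)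
        by-comparison (tri< x<i _ _) = bstShape-substitute-< {x} {w} l+k≡i l+Sb≡x x<i
                                         (IHa (Spans-above s) (m+[n∸m]≡n x<i) i<h)
        by-comparison (tri≈ _ x≡i _) = bstShape-substitute-≡ {x} {w} l+k≡i l+Sb≡x x≡i
        by-comparison (tri> _ _ i<x) = bstShape-substitute-> {x} {w} l+k≡i l+Sb≡x i<x (IHb (Spans-below s) l+k≡i i<x)

compW≡substitute : ∀ i d u v → compW i (suc d) u v ≡ Substitution.substitute i d (inc (i ∸ 1) 0 v) u
compW≡substitute i d u v = trans (concatMap-map replace shift u) (concatMap-cong (λ y → letter y (<-cmp y i)) u)
  where
  V = inc (i ∸ 1) 0 v
  open Substitution i d V
  replace : ℕ → List ℕ
  replace x = if x ≡ᵇ i then V else [ x ]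
  shift : ℕ → ℕ
  shift x = if i <ᵇ x then x + d else x
  shift-≤ : ∀ {y} → y ≤ i → shift y ≡ y
  shift-≤ {y} y≤i with i <ᵇ y | <ᵇ⇒< i y
  ... | false | _   = refl
  ... | true  | i<y = contradiction (i<y _) (≤⇒≯ y≤i)
  shift-> : ∀ {y} → i < y → shift y ≡ y + d
  shift-> {y} i<y with i <ᵇ y | <⇒<ᵇ i<y
  ... | true | _ = refl
  replace-≢ : ∀ {x} → x ≢ i → replace x ≡ [ x ]
  replace-≢ {x} x≢i with x ≡ᵇ i | ≡ᵇ⇒≡ x i
  ... | false | _   = refl
  ... | true  | x≡i = contradiction (x≡i _) x≢i
  replace-≡ : replace i ≡ V
  replace-≡ with i ≡ᵇ i | ≡⇒≡ᵇ i i refl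
  ... | true | _ = refl
  letter : ∀ y → Tri (y < i) (y ≡ i) (i < y) → replace (shift y) ≡ σ y
  letter y (tri< y<i _ _) = trans (cong replace (shift-≤ (<⇒≤ y<i))) (trans (replace-≢ (<⇒≢ y<i)) (sym (σ-< y<i)))
  letter y (tri≈ _ refl _) = trans (cong replace (shift-≤ ≤-refl)) (trans replace-≡ (sym σ-≡))
  letter y (tri> _ _ i<y) = trans (cong replace (shift-> i<y))
                                  (trans (replace-≢ (<⇒≢ (<-≤-trans i<y (m≤m+n y d)) ∘ sym)) (sym (σ-> i<y)))

inc-positive : ∀ α v → (∀ {x} → x ∈ v → 0 < x) → inc α 0 v ≡ map (_+ α) v
inc-positive α []          _   = refl
inc-positive α (zero ∷ v)  pos = contradiction (pos (here refl)) (<-irrefl refl)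
inc-positive α (suc x ∷ v) pos = cong (suc x + α ∷_) (inc-positive α v (pos ∘ there))

bstShape-compW : ∀ {n m i u v} → Packed n u → Packed m v → 1 ≤ m → 1 ≤ i → i ≤ n →
                 bstShape (compW i m u v) ≡ compT i (bstShape u) (bstShape v)
bstShape-compW {m = suc d} {suc i′} {u} {v} pu pv _ _ i≤n = begin
  bstShape (compW (suc i′) (suc d) u v)   ≡⟨ cong bstShape (compW≡substitute (suc i′) d u v) ⟩
  bstShape (substitute u)                 ≡⟨ bstShape-substitute V≢[] V⊆ u (Packed⇒Spans pu) refl (s≤s i≤n) ⟩
  compT (suc i′) (bstShape u) (bstShape V) ≡⟨ cong (compT (suc i′) (bstShape u)) V~v ⟩
  compT (suc i′) (bstShape u) (bstShape v) ∎
  where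
  open ≡-Reasoning
  V = inc i′ 0 v
  open Substitution (suc i′) d V
  V≡ : V ≡ map (_+ i′) v
  V≡ = inc-positive i′ v (proj₁ ∘ proj₁ pv _)
  V~v : bstShape V ≡ bstShape v
  V~v = trans (cong bstShape V≡) (bstShape-map (+-monoˡ-< i′) v)
  V≢[] : V ≢ []
  V≢[] V≡[] = ¬Any[] (subst (_ ∈_) (trans (sym V≡) V≡[]) (∈-map⁺ (_+ i′) (proj₂ pv 1 ≤-refl (s≤s z≤n))))
  V⊆ : ∀ {z} → z ∈ V → suc i′ ≤ z × z ≤ suc i′ + d
  V⊆ z∈V with ∈-map⁻ (_+ i′) (subst (_ ∈_) V≡ z∈V)
  ... | x , x∈v , refl = +-monoˡ-≤ i′ 1≤x , ≤-trans (+-monoˡ-≤ i′ x≤1+d) (≤-reflexive (cong suc (+-comm d i′)))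
    where
    1≤x = proj₁ (proj₁ pv x x∈v)
    x≤1+d = proj₂ (proj₁ pv x x∈v)

proposition3p4 : Σ[ φ ∈ (List ℕ → Tree) ] IsOperadIso φ
proposition3p4 = bstShape , record
  { arity   = λ _ _ _ → size-bstShape-Packed
  ; classes = λ _ _ _ _ pu pv → mk⇔ ≈⇒bstShape≡ (bstShape≡⇒≈ pu pv)
  ; surj    = λ _ t _ size≡n → preorder (labelInorder t 1)
                             , subst (λ n → Packed n (preorder (labelInorder t 1))) size≡n (Spans⇒Packed (Spans-labelInorder t 1))
                             , bstShape-labelInorder t 1
  ; compat  = λ _ _ _ _ _ _ 1≤m pu pv 1≤i i≤n → bstShape-compW pu pv 1≤m 1≤i i≤n
  }
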